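{- Let $\mathcal C\subseteq 2^{[n]}$ be an intersection-complete neural code and $\mathcal I\subseteq\mathcal C$ an isolated subset with minimal element $\mu$. Then the code $\mathcal C_{[\mathcal I]}=\{\mu\}\cup(\mathcal C\setminus\mathcal I)\cup(\mathcal I)_\alpha$ is intersection-complete.
   Context: A neural code is a set $\mathcal C\subseteq 2^{[n]}$ containing $\varnothing$. A code is intersection-complete if $\sigma\cap\tau\in\mathcal C$ for all $\sigma,\tau\in\mathcal C$. If $\mathcal C$ is intersection-complete, a subset $\mathcal I\subseteq\mathcal C$ is isolated if it is nonempty and closed under pairwise intersection (so it has a least element $\mu$), and there are no $\sigma\in\mathcal C\setminus\mathcal I$ and $\tau\in\mathcal I\setminus\{\mu\}$ with $\tau\subseteq\sigma$. Here $\alpha\notin[n]$ is a new neuron and $(S)_\alpha=\{c\cup\{\alpha\}:c\in S\}$. -}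

module Defs where

open import Data.Nat using (ℕ; suc)
open import Data.Fin.Subset using (Subset; _∩_; _⊆_; ⊥; inside; outside)
open import Data.Vec using (_∷_)
open import Data.Product using (_×_; ∃)
open import Data.Sum using (_⊎_)
open import Relation.Nullary using (¬_)
open import Relation.Binary.PropositionalEquality using (_≡_)

Code : ℕ → Set₁
Code n = Subset n → Set

IsNeuralCode : ∀ {n} → Code n → Set
IsNeuralCode C = C ⊥

IntersectionComplete : ∀ {n} → Code n → Set
IntersectionComplete C = ∀ σ τ → C σ → C τ → C (σ ∩ τ)

record Isolated {n} (C I : Code n) (μ : Subset n) : Set where
  field
    I⊆C       : ∀ σ → I σ → C σ
    μ∈I       : I μ
    μ-least   : ∀ τ → I τ → μ ⊆ τ
    ∩-closed  : ∀ σ τ → I σ → I τ → I (σ ∩ τ)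
    isolation : ∀ σ τ → C σ → ¬ I σ → I τ → ¬ (τ ≡ μ) → ¬ (τ ⊆ σ)

-- The new neuron α is index zero of Fin (suc n); old neuron i becomes suc i.
-- So c ⊆ [n] is  outside ∷ c,  and  c ∪ {α}  is  inside ∷ c.
-- C_[I] = {μ} ∪ (C ∖ I) ∪ (I)_α
data Modified {n} (C I : Code n) (μ : Subset n) : Code (suc n) where
  mu     : Modified C I μ (outside ∷ μ)
  old    : ∀ c → C c → ¬ I c → Modified C I μ (outside ∷ c)
  lifted : ∀ c → I c → Modified C I μ (inside ∷ c)

{-# OPTIONS --safe #-}
-- Intersections within (I)_α stay in (I)_α because I is closed under
-- intersection, and an intersection of μ with (a codeword coming from) I is μ
-- itself because μ is least in I. Every other intersection lies below some
-- σ ∈ C ∖ I and belongs to C; by isolation it is then μ or lies outside I.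
module Submission where

open import Defs
open import Data.Nat using (ℕ)
open import Data.Bool using (Bool)
open import Data.Bool.Properties using () renaming (_≟_ to _≟ᴮ_)
open import Data.Fin.Subset using (Subset; _∩_; _⊆_; outside)
open import Data.Fin.Subset.Properties using (p∩q⊆p; p∩q⊆q; ∩-comm; ⊆-antisym; x∈p∩q⁺)
open import Data.Vec using (_∷_)
open import Data.Vec.Properties using (≡-dec)
open import Data.Product using (_,_)
open import Relation.Nullary using (¬_; yes; no)
open import Relation.Binary.PropositionalEquality using (_≡_; refl; trans)

p⊆q⇒p∩q≡p : ∀ {n} {p q : Subset n} → p ⊆ q → p ∩ q ≡ p
p⊆q⇒p∩q≡p {p = p} {q} p⊆q = ⊆-antisym (p∩q⊆p p q) (λ x∈p → x∈p∩q⁺ (x∈p , p⊆q x∈p))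

module _ {n} {C I : Code n} {μ : Subset n} (iso : Isolated C I μ) where
  open Isolated iso

  μ∩c≡μ : ∀ {c} → I c → μ ∩ c ≡ μ
  μ∩c≡μ Ic = p⊆q⇒p∩q≡p (μ-least _ Ic)

  c∩μ≡μ : ∀ {c} → I c → c ∩ μ ≡ μ
  c∩μ≡μ {c} Ic = trans (∩-comm c μ) (μ∩c≡μ Ic)

  outside∷μ : ∀ {τ} → τ ≡ μ → Modified C I μ (outside ∷ τ)
  outside∷μ refl = mu

  Modified-∷⇒C : ∀ {s : Bool} {c} → Modified C I μ (s ∷ c) → C c
  Modified-∷⇒C mu             = I⊆C μ μ∈I
  Modified-∷⇒C (old c Cc _)   = Cc
  Modified-∷⇒C (lifted c Ic)  = I⊆C c Ic

  below-old : ∀ {σ τ} → C σ → ¬ I σ → C τ → τ ⊆ σ → Modified C I μ (outside ∷ τ)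
  below-old {σ} {τ} Cσ ¬Iσ Cτ τ⊆σ with ≡-dec _≟ᴮ_ τ μ
  ... | yes τ≡μ = outside∷μ τ≡μ
  ... | no τ≢μ  = old τ Cτ (λ Iτ → isolation σ τ Cσ ¬Iσ Iτ τ≢μ τ⊆σ)

  Modified-∩-closed : IntersectionComplete C → IntersectionComplete (Modified C I μ)
  Modified-∩-closed C-∩ _ (_ ∷ b) (old a Ca ¬Ia) m =
    below-old Ca ¬Ia (C-∩ a b Ca (Modified-∷⇒C m)) (p∩q⊆p a b)
  Modified-∩-closed C-∩ _ _ mu (old b Cb ¬Ib) =
    below-old Cb ¬Ib (C-∩ μ b (I⊆C μ μ∈I) Cb) (p∩q⊆q μ b)
  Modified-∩-closed C-∩ _ _ (lifted a Ia) (old b Cb ¬Ib) =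
    below-old Cb ¬Ib (C-∩ a b (I⊆C a Ia) Cb) (p∩q⊆q a b)
  Modified-∩-closed _ _ _ mu            mu            = outside∷μ (μ∩c≡μ μ∈I)
  Modified-∩-closed _ _ _ mu            (lifted c Ic) = outside∷μ (μ∩c≡μ Ic)
  Modified-∩-closed _ _ _ (lifted c Ic) mu            = outside∷μ (c∩μ≡μ Ic)
  Modified-∩-closed _ _ _ (lifted a Ia) (lifted b Ib) = lifted (a ∩ b) (∩-closed a b Ia Ib)

proposition35 : (n : ℕ) (C I : Code n) (μ : Subset n) →
                IsNeuralCode C → IntersectionComplete C → Isolated C I μ →
                IntersectionComplete (Modified C I μ)
proposition35 _ _ _ _ _ C-∩ iso = Modified-∩-closed iso C-∩
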